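{- Let $k\ge1$ and let $G$ be a $k$-tree with maximum degree $\Delta$. Then $G$ has a rooted tree-partition $(T,\{T_x:x\in V(T)\})$ such that for all nodes $x$ of $T$: (a) if $x$ is a non-root node of $T$ and $y$ is the parent node of $x$, then the set of vertices in $T_y$ with a neighbour in $T_x$ forms a clique $C_x$ of $G$; and (b) the induced subgraph $G[T_x]$ is a connected $(k-1)$-tree. Furthermore the width of $(T,\{T_x:x\in V(T)\})$ is at most $\max\{1,k(\Delta-1)\}$.
   Context: A $k$-tree is defined recursively: the empty graph is a $k$-tree, and the graph obtained from a $k$-tree by adding a new vertex adjacent to every vertex of a clique with at most $k$ vertices is a $k$-tree. A tree-partition of a graph $G$ is a tree $T$ together with pairwise disjoint sets (bags) $T_x\subseteq V(G)$, $x\in V(T)$, whose union is $V(G)$, such that for every edge $vw$ of $G$ either $v,w\in T_x$ for some node $x$, or $v\in T_x$, $w\in T_y$ for some edge $xy$ of $T$. It is rooted if $T$ is rooted at some node. Its width is the maximum cardinality of a bag. -}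

module Defs where

open import Data.Nat using (ℕ; zero; suc; _≤_; _∸_; _*_; _⊔_)
open import Data.Fin using (Fin; _≟_)
open import Data.Bool using (Bool; true; false; if_then_else_)
open import Data.List using (List; []; _∷_; length; map; foldr; allFin)
open import Data.Nat.ListAction using (sum)
open import Data.List.Membership.Propositional using (_∈_; _∉_)
open import Data.List.Relation.Unary.All using (All)
open import Data.List.Relation.Unary.Unique.Propositional using (Unique)
open import Data.Maybe using (Maybe; just; nothing)
open import Data.Product using (Σ; _×_; ∃; ∃-syntax)
open import Data.Sum using (_⊎_)
open import Function.Bundles using (_⇔_)
open import Relation.Binary.PropositionalEquality using (_≡_; _≢_)
open import Relation.Nullary.Decidable using (⌊_⌋)

record Graph : Set where
  field
    n      : ℕ
    adj    : Fin n → Fin n → Bool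
    sym    : ∀ u v → adj u v ≡ adj v u
    irrefl : ∀ v → adj v v ≡ false
open Graph public

Vertex : Graph → Set
Vertex G = Fin (n G)

Adj : (G : Graph) → Vertex G → Vertex G → Set
Adj G u v = adj G u v ≡ true

-- degree and maximum degree (max degree of the empty graph is 0)
degree : (G : Graph) → Vertex G → ℕ
degree G v = sum (map (λ u → if adj G v u then 1 else 0) (allFin (n G)))

maxDegree : Graph → ℕ
maxDegree G = foldr _⊔_ 0 (map (degree G) (allFin (n G)))

IsClique : (G : Graph) → List (Vertex G) → Set
IsClique G C = ∀ {a b} → a ∈ C → b ∈ C → a ≢ b → Adj G a b

-- KTreeOn G k S : the induced subgraph G[S] is a k-tree, built by the
-- recursive definition, where S lists the vertices in reverse insertion
-- order.
data KTreeOn (G : Graph) (k : ℕ) : List (Vertex G) → Set where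
  empty : KTreeOn G k []
  add   : ∀ {S} (v : Vertex G) (C : List (Vertex G)) →
          KTreeOn G k S →
          v ∉ S →
          Unique C →
          All (_∈ S) C →
          IsClique G C →
          length C ≤ k →
          (∀ u → u ∈ S → (Adj G v u ⇔ u ∈ C)) →
          KTreeOn G k (v ∷ S)

InducedKTree : (G : Graph) → ℕ → (Vertex G → Set) → Set
InducedKTree G k P = Σ (List (Vertex G)) λ S → KTreeOn G k S × (∀ v → (v ∈ S ⇔ P v))

IsKTree : ℕ → Graph → Set
IsKTree k G = InducedKTree G k (λ _ → Data.Unit.⊤)
  where import Data.Unit

data WalkIn (G : Graph) (P : Vertex G → Set) : Vertex G → Vertex G → Set where
  here : ∀ {u} → WalkIn G P u u
  step : ∀ {u w v} → Adj G u w → P w → WalkIn G P w v → WalkIn G P u v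

InducedConnected : (G : Graph) → (Vertex G → Set) → Set
InducedConnected G P = ∀ u v → P u → P v → WalkIn G P u v

-- The depth function forces the
-- parent relation to be acyclic; the root is the unique node with no parent,
-- so T is a tree rooted at root.
record RootedTree : Set where
  field
    m       : ℕ
    root    : Fin m
    parent  : Fin m → Maybe (Fin m)
    rootP   : ∀ x → parent x ≡ nothing ⇔ x ≡ root
    depth   : Fin m → ℕ
    depthP  : ∀ x y → parent x ≡ just y → depth x ≡ suc (depth y)
open RootedTree public

TreeEdge : (T : RootedTree) → Fin (m T) → Fin (m T) → Set
TreeEdge T x y = parent T x ≡ just y ⊎ parent T y ≡ just x

-- A rooted tree-partition of G: a rooted tree T and an assignment of each
-- vertex to the node whose bag contains it (so bags T_x = {v | bag v ≡ x}
-- are pairwise disjoint and cover V(G)).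
record RootedTreePartition (G : Graph) : Set where
  field
    tree    : RootedTree
    bag     : Vertex G → Fin (m tree)
    edgeOK  : ∀ v w → Adj G v w → bag v ≡ bag w ⊎ TreeEdge tree (bag v) (bag w)
open RootedTreePartition public

InBag : {G : Graph} (P : RootedTreePartition G) → Fin (m (tree P)) → Vertex G → Set
InBag P x v = bag P v ≡ x

bagSize : {G : Graph} (P : RootedTreePartition G) → Fin (m (tree P)) → ℕ
bagSize {G} P x = sum (map (λ v → if ⌊ bag P v ≟ x ⌋ then 1 else 0) (allFin (n G)))

WidthAtMost : {G : Graph} → RootedTreePartition G → ℕ → Set
WidthAtMost P w = ∀ x → bagSize P x ≤ w

AttachSet : {G : Graph} (P : RootedTreePartition G) → (x y : Fin (m (tree P))) → Vertex G → Set
AttachSet {G} P x y v = InBag P y v × ∃[ w ] (InBag P x w × Adj G v w)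

PropA : {G : Graph} → RootedTreePartition G → Set
PropA {G} P = ∀ x y → parent (tree P) x ≡ just y →
  ∀ u v → AttachSet P x y u → AttachSet P x y v → u ≢ v → Adj G u v

PropB : {G : Graph} → ℕ → RootedTreePartition G → Set
PropB {G} k P = ∀ x → InducedConnected G (InBag P x) × InducedKTree G (k ∸ 1) (InBag P x)

{-# OPTIONS --safe #-}
module Submission where

-- Insert the vertices in the order of a k-tree construction.  When v arrives, attached to
-- the clique C, the bags meeting C are pairwise equal or adjacent in T; since T has no
-- triangles, C lies in a single bag p or in a bag t and its parent p.  In the first case v
-- opens a new child bag of p and records C as its clique C_x; in the second v joins t,
-- where it sees at most k - 1 earlier vertices because C also meets p.  Hence every bag
-- grows as a connected (k-1)-tree, and every vertex of a parent bag with a neighbour in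
-- bag x belongs to the recorded clique C_x.
-- For the width, every vertex of bag x is adjacent to some vertex of C_x.  If |C_x| ≥ 2,
-- each vertex of C_x spends one of its Δ edges inside C_x, which lies in the parent bag,
-- so |T_x| ≤ |C_x|(Δ - 1) ≤ k(Δ - 1); if |C_x| = 1 then |T_x| ≤ Δ ≤ max{1, k(Δ - 1)} for
-- k ≥ 2; and if C_x = ∅ or k ≤ 1 the bag consists of the single vertex that opened it.

open import Defs hiding (sym)
open import Data.Bool using (true; false; if_then_else_)
open import Data.Empty using (⊥; ⊥-elim)
open import Data.Fin using (Fin; zero; suc; _≟_)
open import Data.Fin.Properties using (suc-injective)
open import Data.List using (List; []; _∷_; length; map; foldr; filter; allFin; tabulate)
open import Data.List.Properties using (map-tabulate; foldr-preservesᵒ; filter-none; filter-notAll; filter-some)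
open import Data.List.Membership.Propositional using (_∈_; _∉_; find)
open import Data.List.Membership.Propositional.Properties using (∈-map⁺; ∈-allFin; ∈-filter⁺; ∈-filter⁻)
open import Data.List.Relation.Unary.All as All using (All; []; _∷_; all?)
open import Data.List.Relation.Unary.All.Properties.Core using (¬All⇒Any¬)
open import Data.List.Relation.Unary.AllPairs using ([]; _∷_)
open import Data.List.Relation.Unary.Any as Any using (Any; here; there)
open import Data.List.Relation.Unary.Unique.Propositional using (Unique)
import Data.List.Relation.Unary.Unique.Propositional.Properties as Unique
open import Data.Maybe using (Maybe; just; nothing)
open import Data.Maybe.Properties using (just-injective)
open import Data.Nat using (ℕ; zero; suc; _+_; _*_; _≤_; _<_; _∸_; _⊔_; z≤n; s≤s; _≤?_; _<?_)
open import Data.Nat.ListAction using (sum)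
open import Data.Nat.Properties
  using (module ≤-Reasoning; ≤-refl; ≤-reflexive; ≤-trans; <-≤-trans; +-mono-≤; +-mono-≤-<; +-mono-<-≤;
         *-monoˡ-≤; ∸-monoˡ-≤; +-identityʳ; m≤m+n; m≤n+m; m≤m⊔n; m≤n⇒m≤n⊔o; m≤n⇒m≤o⊔n; n≤0⇒n≡0; ≮⇒≥;
         1+n≢n; m≢1+n+m; +-0-commutativeMonoid)
open import Algebra.Properties.CommutativeMonoid.Sum +-0-commutativeMonoid
  using (∑-distrib-+; sum-replicate-zero) renaming (sum to ∑)
open import Data.Product using (Σ; _×_; _,_; proj₁; proj₂; ∃-syntax)
open import Data.Sum using (_⊎_; inj₁; inj₂; [_,_])
open import Data.Unit using (tt)
open import Data.Vec.Functional using (updateAt)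
open import Data.Vec.Functional.Properties using (updateAt-updates; updateAt-minimal)
open import Function using (_∘_; id; const)
open import Function.Bundles using (_⇔_; mk⇔; Equivalence)
open import Relation.Binary.Definitions using (DecidableEquality)
open import Relation.Binary.PropositionalEquality using (_≡_; _≢_; refl; sym; trans; cong; subst; subst₂)
open import Relation.Nullary using (¬_; Dec; yes; no)
open import Relation.Nullary.Decidable using (⌊_⌋)

sum-tabulate : ∀ {n} (f : Fin n → ℕ) → sum (tabulate f) ≡ ∑ f
sum-tabulate {zero}  f = refl
sum-tabulate {suc n} f = cong (f zero +_) (sum-tabulate (f ∘ suc))

sum-map-allFin : ∀ {n} (f : Fin n → ℕ) → sum (map f (allFin n)) ≡ ∑ f
sum-map-allFin {n} f = trans (cong sum (map-tabulate id f)) (sum-tabulate f)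

∑-mono-≤ : ∀ {n} {f g : Fin n → ℕ} → (∀ i → f i ≤ g i) → ∑ f ≤ ∑ g
∑-mono-≤ {zero}  f≤g = z≤n
∑-mono-≤ {suc n} f≤g = +-mono-≤ (f≤g zero) (∑-mono-≤ (f≤g ∘ suc))

∑-mono-< : ∀ {n} {f g : Fin n → ℕ} → (∀ i → f i ≤ g i) → ∀ j → f j < g j → ∑ f < ∑ g
∑-mono-< f≤g zero    fj<gj = +-mono-<-≤ fj<gj (∑-mono-≤ (f≤g ∘ suc))
∑-mono-< f≤g (suc j) fj<gj = +-mono-≤-< (f≤g zero) (∑-mono-< (f≤g ∘ suc) j fj<gj)

∑-≤1 : ∀ {n} {f : Fin n → ℕ} → (∀ i → f i ≤ 1) → (∀ i j → 0 < f i → 0 < f j → i ≡ j) → ∑ f ≤ 1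
∑-≤1 {zero}          f≤1 unique = z≤n
∑-≤1 {suc n} {f} f≤1 unique with 0 <? f zero
... | no f₀≯0 rewrite n≤0⇒n≡0 (≮⇒≥ f₀≯0) =
  ∑-≤1 (f≤1 ∘ suc) λ i j fi>0 fj>0 → suc-injective (unique (suc i) (suc j) fi>0 fj>0)
... | yes f₀>0 = +-mono-≤ (f≤1 zero) (≤-trans (∑-mono-≤ rest≤0) (≤-reflexive (sum-replicate-zero n)))
  where
  rest≤0 : ∀ i → f (suc i) ≤ 0
  rest≤0 i with 0 <? f (suc i)
  ... | yes fi>0 with () ← unique zero (suc i) f₀>0 fi>0
  ... | no fi≯0 = ≮⇒≥ fi≯0

∑-sum-comm : ∀ {A : Set} {n} (f : A → Fin n → ℕ) (L : List A) →
             ∑ (λ i → sum (map (λ a → f a i) L)) ≡ sum (map (λ a → ∑ (f a)) L)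
∑-sum-comm {n = n} f []      = sum-replicate-zero n
∑-sum-comm         f (a ∷ L) = trans (∑-distrib-+ (f a) _) (cong (∑ (f a) +_) (∑-sum-comm f L))

sum-map-member : ∀ {A : Set} (f : A → ℕ) {a L} → a ∈ L → f a ≤ sum (map f L)
sum-map-member f {L = b ∷ L} (here refl) = m≤m+n (f b) _
sum-map-member f {L = b ∷ L} (there a∈L) = ≤-trans (sum-map-member f a∈L) (m≤n+m _ (f b))

sum-map-≤-* : ∀ {A : Set} (f : A → ℕ) {B} (L : List A) → (∀ {a} → a ∈ L → f a ≤ B) → sum (map f L) ≤ length L * B
sum-map-≤-* f []      _   = z≤n
sum-map-≤-* f (a ∷ L) f≤B = +-mono-≤ (f≤B (here refl)) (sum-map-≤-* f L (f≤B ∘ there))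

≤-foldr-⊔ : ∀ {z L} → z ∈ L → z ≤ foldr _⊔_ 0 L
≤-foldr-⊔ {z} {L} z∈L =
  foldr-preservesᵒ (λ x y → [ m≤n⇒m≤n⊔o y , m≤n⇒m≤o⊔n x ]) 0 L (inj₂ (Any.map ≤-reflexive z∈L))

n≤1⊔k*[n∸1] : ∀ {k} n → 2 ≤ k → n ≤ 1 ⊔ k * (n ∸ 1)
n≤1⊔k*[n∸1]     zero          _   = z≤n
n≤1⊔k*[n∸1] {k} (suc zero)    _   = m≤m⊔n 1 (k * 0)
n≤1⊔k*[n∸1] {k} (suc (suc d)) 2≤k = m≤n⇒m≤o⊔n 1 (begin
  suc (suc d)      ≤⟨ s≤s (m≤n+m (suc d) d) ⟩
  suc d + suc d    ≡⟨ cong (suc d +_) (sym (+-identityʳ (suc d))) ⟩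
  2 * suc d        ≤⟨ *-monoˡ-≤ (suc d) 2≤k ⟩
  k * suc d        ∎)
  where open ≤-Reasoning

𝟙[_] : ∀ {A : Set} → Dec A → ℕ
𝟙[ d ] = if ⌊ d ⌋ then 1 else 0

𝟙-≤1 : ∀ {A : Set} (d : Dec A) → 𝟙[ d ] ≤ 1
𝟙-≤1 (yes _) = ≤-refl
𝟙-≤1 (no _)  = z≤n

𝟙-pos : ∀ {A : Set} (d : Dec A) → 0 < 𝟙[ d ] → A
𝟙-pos (yes a) _ = a

𝟙-no : ∀ {A : Set} → ¬ A → (d : Dec A) → 𝟙[ d ] ≡ 0
𝟙-no ¬a (yes a) with () ← ¬a a
𝟙-no ¬a (no _)  = refl

if-monoʳ : ∀ b {m n} → m ≤ n → (if b then m else 0) ≤ (if b then n else 0)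
if-monoʳ true  m≤n = m≤n
if-monoʳ false _   = z≤n

other-member : ∀ {A : Set} {a b : A} {r} → Unique (a ∷ b ∷ r) → ∀ {c} → c ∈ a ∷ b ∷ r → ∃[ d ] d ∈ a ∷ b ∷ r × c ≢ d
other-member ((a≢b ∷ _) ∷ _)  (here refl)  = _ , there (here refl) , a≢b
other-member (a≢b∷r ∷ _)       (there c∈br) = _ , here refl , λ { refl → All.lookup a≢b∷r c∈br refl }

Adj-sym : ∀ G {u w} → Adj G u w → Adj G w u
Adj-sym G {u} {w} uw = trans (Graph.sym G w u) uw

Adj-irrefl : ∀ G {u} → Adj G u u → ⊥
Adj-irrefl G {u} uu with () ← trans (sym uu) (irrefl G u)

module _ {G : Graph} {P : Vertex G → Set} where

  WalkIn-++ : ∀ {u w z} → WalkIn G P u w → WalkIn G P w z → WalkIn G P u z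
  WalkIn-++ here          q = q
  WalkIn-++ (step a pw p) q = step a pw (WalkIn-++ p q)

  WalkIn-reverse : ∀ {u w} → P u → WalkIn G P u w → WalkIn G P w u
  WalkIn-reverse pu here          = here
  WalkIn-reverse pu (step a pw p) = WalkIn-++ (WalkIn-reverse pw p) (step (Adj-sym G a) pu here)

  WalkIn-map : ∀ {Q : Vertex G → Set} → (∀ {z} → P z → Q z) → ∀ {u w} → WalkIn G P u w → WalkIn G Q u w
  WalkIn-map f here          = here
  WalkIn-map f (step a pw p) = step a (f pw) (WalkIn-map f p)

degree≤maxDegree : ∀ G v → degree G v ≤ maxDegree G
degree≤maxDegree G v = ≤-foldr-⊔ (∈-map⁺ (degree G) (∈-allFin v))

module ParentForest {N : Set} (parent : N → Maybe N) (depth : N → ℕ)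
  (depth-parent : ∀ x y → parent x ≡ just y → depth x ≡ suc (depth y)) where

  Near : N → N → Set
  Near a b = a ≡ b ⊎ (parent a ≡ just b ⊎ parent b ≡ just a)

  Near-sym : ∀ {a b} → Near a b → Near b a
  Near-sym (inj₁ a≡b)        = inj₁ (sym a≡b)
  Near-sym (inj₂ (inj₁ pab)) = inj₂ (inj₂ pab)
  Near-sym (inj₂ (inj₂ pba)) = inj₂ (inj₁ pba)

  parent-irrefl : ∀ {x y} → parent x ≡ just y → x ≢ y
  parent-irrefl {x} px≡x refl = 1+n≢n (sym (depth-parent x x px≡x))

  parent-asym : ∀ {x y} → parent x ≡ just y → parent y ≡ just x → ⊥
  parent-asym {x} {y} pxy pyx =
    m≢1+n+m (depth x) {1} (trans (depth-parent x y pxy) (cong suc (depth-parent y x pyx)))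

  -- A common neighbour of t and its parent p would close a cycle of length 3.
  Near-edge : ∀ {t p z} → parent t ≡ just p → Near z t → Near z p → z ≡ t ⊎ z ≡ p
  Near-edge _   (inj₁ z≡t)        _                 = inj₁ z≡t
  Near-edge ptp (inj₂ (inj₂ ptz)) _                 = inj₂ (just-injective (trans (sym ptz) ptp))
  Near-edge _   (inj₂ (inj₁ _))   (inj₁ z≡p)        = inj₂ z≡p
  Near-edge ptp (inj₂ (inj₁ pzt)) (inj₂ (inj₁ pzp)) =
    ⊥-elim (parent-irrefl ptp (just-injective (trans (sym pzt) pzp)))
  Near-edge {t} {p} {z} ptp (inj₂ (inj₁ pzt)) (inj₂ (inj₂ ppz)) =
    ⊥-elim (m≢1+n+m (depth t) {2}
      (trans (depth-parent t p ptp) (cong suc (trans (depth-parent p z ppz) (cong suc (depth-parent z t pzt))))))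

  module _ {A : Set} (f : A → N) where

    data Span (L : List A) : Set where
      within : ∀ p → All (λ a → f a ≡ p) L → Span L
      across : ∀ t p → parent t ≡ just p → All (λ a → f a ≡ t ⊎ f a ≡ p) L →
               Any (λ a → f a ≡ t) L → Any (λ a → f a ≡ p) L → Span L

    span : DecidableEquality N → ∀ a L → (∀ {b c} → b ∈ a ∷ L → c ∈ a ∷ L → Near (f b) (f c)) → Span (a ∷ L)
    span _≟_ a L near with all? (λ b → f b ≟ f a) (a ∷ L)
    ... | yes all≡ = within (f a) all≡
    ... | no ¬all≡ with find (¬All⇒Any¬ (λ b → f b ≟ f a) (a ∷ L) ¬all≡)
    ... | c , c∈ , fc≢fa = spanning (near (here refl) c∈)
      where
      a-hit : Any (λ b → f b ≡ f a) (a ∷ L)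
      a-hit = here refl
      c-hit : Any (λ b → f b ≡ f c) (a ∷ L)
      c-hit = Any.map (λ c≡b → cong f (sym c≡b)) c∈
      spanning : Near (f a) (f c) → Span (a ∷ L)
      spanning (inj₁ fa≡fc)      = ⊥-elim (fc≢fa (sym fa≡fc))
      spanning (inj₂ (inj₁ pac)) =
        across (f a) (f c) pac (All.tabulate λ b∈ → Near-edge pac (near b∈ (here refl)) (near b∈ c∈)) a-hit c-hit
      spanning (inj₂ (inj₂ pca)) =
        across (f c) (f a) pca (All.tabulate λ b∈ → Near-edge pca (near b∈ c∈) (near b∈ (here refl))) c-hit a-hit

module FiberCount (G : Graph) {m} (bag : Vertex G → Fin m) (x : Fin m) where

  inFiber : Vertex G → ℕ
  inFiber w = 𝟙[ bag w ≟ x ]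

  fiberSize : ℕ
  fiberSize = sum (map inFiber (allFin (n G)))

  neighbourInFiber : Vertex G → Vertex G → ℕ
  neighbourInFiber a w = if adj G a w then inFiber w else 0

  private
    isNeighbour : Vertex G → Vertex G → ℕ
    isNeighbour a w = if adj G a w then 1 else 0

    neighbourInFiber-adj : ∀ {a w} → Adj G a w → neighbourInFiber a w ≡ inFiber w
    neighbourInFiber-adj {a} {w} aw = cong (λ b → if b then inFiber w else 0) aw

    neighbourInFiber-< : ∀ {a c} → Adj G a c → bag c ≢ x → neighbourInFiber a c < isNeighbour a c
    neighbourInFiber-< {a} {c} ac c∉x =
      subst₂ _<_ (sym (trans (neighbourInFiber-adj ac) (𝟙-no c∉x (bag c ≟ x))))
                 (sym (cong (λ b → if b then 1 else 0) ac)) (s≤s z≤n)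

    neighbourInFiber-≤ : ∀ a w → neighbourInFiber a w ≤ isNeighbour a w
    neighbourInFiber-≤ a w = if-monoʳ (adj G a w) (𝟙-≤1 (bag w ≟ x))

    ∑-isNeighbour-≤ : ∀ a → ∑ (isNeighbour a) ≤ maxDegree G
    ∑-isNeighbour-≤ a = subst (_≤ maxDegree G) (sum-map-allFin (isNeighbour a)) (degree≤maxDegree G a)

  ∑-neighbourInFiber-≤ : ∀ a → ∑ (neighbourInFiber a) ≤ maxDegree G
  ∑-neighbourInFiber-≤ a = ≤-trans (∑-mono-≤ (neighbourInFiber-≤ a)) (∑-isNeighbour-≤ a)

  ∑-neighbourInFiber-≤-pred : ∀ {a c} → Adj G a c → bag c ≢ x → ∑ (neighbourInFiber a) ≤ maxDegree G ∸ 1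
  ∑-neighbourInFiber-≤-pred {a} {c} ac c∉x =
    ∸-monoˡ-≤ 1 (<-≤-trans (∑-mono-< (neighbourInFiber-≤ a) c (neighbourInFiber-< ac c∉x)) (∑-isNeighbour-≤ a))

  fiber-dominated : (L : List (Vertex G)) → (∀ {w} → bag w ≡ x → ∃[ a ] a ∈ L × Adj G a w) →
                    ∀ {B} → (∀ {a} → a ∈ L → ∑ (neighbourInFiber a) ≤ B) → fiberSize ≤ length L * B
  fiber-dominated L dominated {B} bound = begin
    fiberSize                                          ≡⟨ sum-map-allFin inFiber ⟩
    ∑ inFiber                                          ≤⟨ ∑-mono-≤ covered ⟩
    ∑ (λ w → sum (map (λ a → neighbourInFiber a w) L)) ≡⟨ ∑-sum-comm neighbourInFiber L ⟩
    sum (map (λ a → ∑ (neighbourInFiber a)) L)         ≤⟨ sum-map-≤-* _ L bound ⟩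
    length L * B                                       ∎
    where
    open ≤-Reasoning
    covered : ∀ w → inFiber w ≤ sum (map (λ a → neighbourInFiber a w) L)
    covered w = by-membership (bag w ≟ x)
      where
      by-membership : Dec (bag w ≡ x) → inFiber w ≤ sum (map (λ a → neighbourInFiber a w) L)
      by-membership (no w∉x)  = ≤-trans (≤-reflexive (𝟙-no w∉x (bag w ≟ x))) z≤n
      by-membership (yes w∈x) with dominated w∈x
      ... | a , a∈L , aw =
        ≤-trans (≤-reflexive (sym (neighbourInFiber-adj aw))) (sum-map-member (λ b → neighbourInFiber b w) a∈L)

  fiber-subsingleton : (∀ {w w′} → bag w ≡ x → bag w′ ≡ x → w ≡ w′) → fiberSize ≤ 1
  fiber-subsingleton unique = subst (_≤ 1) (sym (sum-map-allFin inFiber))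
    (∑-≤1 (λ w → 𝟙-≤1 (bag w ≟ x)) λ w w′ w∈x w′∈x → unique (𝟙-pos (bag w ≟ x) w∈x) (𝟙-pos (bag w′ ≟ x) w′∈x))

module Construction (G : Graph) (k : ℕ) where

  open ParentForest using (within; across)

  V : Set
  V = Vertex G

  Node : Set
  Node = Fin (suc (n G))

  rootNode : Node
  rootNode = zero

  -- The bag opened when v is inserted (if v opens one) is the node nodeOf v; nodes
  -- that are never opened stay empty children of the root, whose bag stays empty.
  nodeOf : V → Node
  nodeOf = suc

  Dominated : (Node → List V) → V → Node → Set
  Dominated clique w x = (∃[ a ] a ∈ clique x × Adj G a w) ⊎ (clique x ≡ [] × x ≡ nodeOf w)

  -- The state after inserting the vertices of S (bagOf is junk outside S); clique x is the
  -- clique C_x recorded when bag x is opened.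
  record PartialPartition (S : List V) : Set where
    field
      bagOf    : V → Node
      parentOf : Node → Maybe Node
      depthOf  : Node → ℕ
      clique   : Node → List V
      parentOf-root   : parentOf rootNode ≡ nothing
      parentless⇒root : ∀ x → parentOf x ≡ nothing → x ≡ rootNode
      depthOf-parent  : ∀ x y → parentOf x ≡ just y → depthOf x ≡ suc (depthOf y)

    open ParentForest parentOf depthOf depthOf-parent public

    Placed : Node → V → Set
    Placed x z = z ∈ S × bagOf z ≡ x

    field
      edge-near             : ∀ {u w} → u ∈ S → w ∈ S → Adj G u w → Near (bagOf u) (bagOf w)
      unopened-childless    : ∀ {w} → w ∉ S → ∀ x → parentOf x ≢ just (nodeOf w)
      unopened-empty        : ∀ {w u} → w ∉ S → u ∈ S → bagOf u ≢ nodeOf w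
      clique-in-parent      : ∀ x {a} → a ∈ clique x → a ∈ S × ∃[ y ] parentOf x ≡ just y × bagOf a ≡ y
      clique-unique         : ∀ x → Unique (clique x)
      clique-isClique       : ∀ x → IsClique G (clique x)
      clique-length         : ∀ x → length (clique x) ≤ k
      attachments-in-clique : ∀ {x y u w} → parentOf x ≡ just y → Placed y u → Placed x w → Adj G u w → u ∈ clique x
      own-bag-or-2≤k        : ∀ {w} → w ∈ S → bagOf w ≡ nodeOf w ⊎ 2 ≤ k
      dominated-by-clique   : ∀ {w} → w ∈ S → Dominated clique w (bagOf w)
      bag-kTree             : ∀ x → InducedKTree G (k ∸ 1) (Placed x)
      bag-connected         : ∀ x → InducedConnected G (Placed x)

  initialParent : Node → Maybe Node
  initialParent zero    = nothing
  initialParent (suc _) = just rootNode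

  initialDepth : Node → ℕ
  initialDepth zero    = 0
  initialDepth (suc _) = 1

  initial : PartialPartition []
  initial = record
    { bagOf    = const rootNode
    ; parentOf = initialParent
    ; depthOf  = initialDepth
    ; clique   = const []
    ; parentOf-root   = refl
    ; parentless⇒root = λ { zero _ → refl ; (suc _) () }
    ; depthOf-parent  = λ { (suc _) zero refl → refl }
    ; edge-near             = λ ()
    ; unopened-childless    = λ { _ zero () ; _ (suc _) () }
    ; unopened-empty        = λ _ ()
    ; clique-in-parent      = λ _ ()
    ; clique-unique         = λ _ → []
    ; clique-isClique       = λ _ ()
    ; clique-length         = λ _ → z≤n
    ; attachments-in-clique = λ _ ()
    ; own-bag-or-2≤k        = λ ()
    ; dominated-by-clique   = λ ()
    ; bag-kTree             = λ _ → [] , empty , λ _ → mk⇔ (λ ()) (λ ())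
    ; bag-connected         = λ _ _ _ ()
    }

  module OpenBag {S} (st : PartialPartition S) {v} (v∉S : v ∉ S)
    (p : Node) (p-opened : ∀ {w} → w ∉ S → p ≢ nodeOf w)
    {C} (C⊆S : All (_∈ S) C) (C-in-p : All (λ c → PartialPartition.bagOf st c ≡ p) C)
    (C-unique : Unique C) (C-clique : IsClique G C) (C-length : length C ≤ k) where

    open PartialPartition st

    private
      t : Node
      t = nodeOf v

      _[t]≔_ : ∀ {A : Set} → (Node → A) → A → Node → A
      f [t]≔ b = updateAt f t (const b)

      at-t : ∀ {A : Set} (f : Node → A) b → (f [t]≔ b) t ≡ b
      at-t f b = updateAt-updates t f

      off-t : ∀ {A : Set} (f : Node → A) b {x} → x ≢ t → (f [t]≔ b) x ≡ f x
      off-t f b {x} x≢t = updateAt-minimal x t f x≢t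

      preserved : ∀ {A : Set} (P : A → Set) (f : Node → A) {b} → (∀ x → P (f x)) → P b → ∀ x → P ((f [t]≔ b) x)
      preserved P f Pf Pb x with x ≟ t
      ... | yes refl = subst P (sym (at-t f _)) Pb
      ... | no x≢t   = subst P (sym (off-t f _ x≢t)) (Pf x)

      parent≢t : ∀ {x y} → parentOf x ≡ just y → y ≢ t
      parent≢t {x} pxy y≡t = unopened-childless v∉S x (trans pxy (cong just y≡t))

      bag≢t : ∀ {u} → u ∈ S → bagOf u ≢ t
      bag≢t = unopened-empty v∉S

      parentOf′ : Node → Maybe Node
      parentOf′ = parentOf [t]≔ just p

      depthOf′ : Node → ℕ
      depthOf′ = depthOf [t]≔ suc (depthOf p)

      parentless⇒root′ : ∀ x → parentOf′ x ≡ nothing → x ≡ rootNode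
      parentless⇒root′ x px≡nothing with x ≟ t
      ... | yes refl with () ← trans (sym (at-t parentOf _)) px≡nothing
      ... | no x≢t   = parentless⇒root x (trans (sym (off-t parentOf _ x≢t)) px≡nothing)

      depthOf-parent′ : ∀ x y → parentOf′ x ≡ just y → depthOf′ x ≡ suc (depthOf′ y)
      depthOf-parent′ x y pxy with x ≟ t
      ... | yes refl with refl ← just-injective (trans (sym pxy) (at-t parentOf _)) =
        trans (at-t depthOf _) (cong suc (sym (off-t depthOf _ (p-opened v∉S))))
      ... | no x≢t =
        let pxy-old = trans (sym (off-t parentOf _ x≢t)) pxy in
        trans (off-t depthOf _ x≢t)
              (trans (depthOf-parent x y pxy-old) (cong suc (sym (off-t depthOf _ (parent≢t pxy-old)))))

      module New = ParentForest parentOf′ depthOf′ depthOf-parent′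

      Near-lift : ∀ {a b} → a ≢ t → b ≢ t → Near a b → New.Near a b
      Near-lift _   _   (inj₁ a≡b)        = inj₁ a≡b
      Near-lift a≢t _   (inj₂ (inj₁ pab)) = inj₂ (inj₁ (trans (off-t parentOf _ a≢t) pab))
      Near-lift _   b≢t (inj₂ (inj₂ pba)) = inj₂ (inj₂ (trans (off-t parentOf _ b≢t) pba))

      unopened-childless′ : ∀ {w} → w ∉ S → ∀ x → parentOf′ x ≢ just (nodeOf w)
      unopened-childless′ w∉S x px≡w with x ≟ t
      ... | yes refl = p-opened w∉S (just-injective (trans (sym (at-t parentOf _)) px≡w))
      ... | no x≢t   = unopened-childless w∉S x (trans (sym (off-t parentOf _ x≢t)) px≡w)

      clique′ : Node → List V
      clique′ = clique [t]≔ C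

      clique-in-parent′ : ∀ x {a} → a ∈ clique′ x → a ∈ S × ∃[ y ] parentOf′ x ≡ just y × bagOf a ≡ y
      clique-in-parent′ x {a} a∈ with x ≟ t
      ... | yes refl =
        let a∈C = subst (a ∈_) (at-t clique C) a∈ in
        All.lookup C⊆S a∈C , p , at-t parentOf _ , All.lookup C-in-p a∈C
      ... | no x≢t with clique-in-parent x (subst (a ∈_) (off-t clique C x≢t) a∈)
      ...   | a∈S , y , pxy , a∈y = a∈S , y , trans (off-t parentOf _ x≢t) pxy , a∈y

      attachments-in-clique′ : ∀ {x y u w} → parentOf′ x ≡ just y → Placed y u → Placed x w → Adj G u w → u ∈ clique′ x
      attachments-in-clique′ {x} {u = u} pxy pu (w∈S , w∈x) uw =
        let x≢t = λ x≡t → bag≢t w∈S (trans w∈x x≡t) in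
        subst (u ∈_) (sym (off-t clique C x≢t))
          (attachments-in-clique (trans (sym (off-t parentOf _ x≢t)) pxy) pu (w∈S , w∈x) uw)

      dominated-by-clique′ : ∀ {w} → w ∈ S → Dominated clique′ w (bagOf w)
      dominated-by-clique′ w∈S with off-t clique C (bag≢t w∈S) | dominated-by-clique w∈S
      ... | same | inj₁ (a , a∈ , aw) = inj₁ (a , subst (a ∈_) (sym same) a∈ , aw)
      ... | same | inj₂ (none , own)  = inj₂ (trans same none , own)

    openBag : PartialPartition S
    openBag = record
      { bagOf    = bagOf
      ; parentOf = parentOf′
      ; depthOf  = depthOf′
      ; clique   = clique′
      ; parentOf-root   = trans (off-t parentOf (just p) λ ()) parentOf-root
      ; parentless⇒root = parentless⇒root′
      ; depthOf-parent  = depthOf-parent′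
      ; edge-near             = λ u∈S w∈S uw → Near-lift (bag≢t u∈S) (bag≢t w∈S) (edge-near u∈S w∈S uw)
      ; unopened-childless    = unopened-childless′
      ; unopened-empty        = unopened-empty
      ; clique-in-parent      = clique-in-parent′
      ; clique-unique         = preserved Unique clique clique-unique C-unique
      ; clique-isClique       = preserved (IsClique G) clique clique-isClique C-clique
      ; clique-length         = preserved (λ L → length L ≤ k) clique clique-length C-length
      ; attachments-in-clique = attachments-in-clique′
      ; own-bag-or-2≤k        = own-bag-or-2≤k
      ; dominated-by-clique   = dominated-by-clique′
      ; bag-kTree             = bag-kTree
      ; bag-connected         = bag-connected
      }

    openBag-parent : PartialPartition.parentOf openBag (nodeOf v) ≡ just p
    openBag-parent = at-t parentOf _

    openBag-clique : PartialPartition.clique openBag (nodeOf v) ≡ C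
    openBag-clique = at-t clique C

  record Placement {S} (st : PartialPartition S) (v : V) (C : List V) : Set where
    open PartialPartition st
    field
      target above          : Node
      target-parent         : parentOf target ≡ just above
      C-near-target         : All (λ c → bagOf c ≡ target ⊎ bagOf c ≡ above) C
      target-dominates      : Dominated clique v target
      target-own-or-2≤k     : target ≡ nodeOf v ⊎ 2 ≤ k
      target-reached        : Any (λ c → bagOf c ≡ target) C ⊎ (∀ {u} → u ∈ S → bagOf u ≢ target)
      C-above-in-clique     : ∀ {u} → u ∈ C → bagOf u ≡ above → u ∈ clique target
      C-in-target-length    : length (filter (λ c → bagOf c ≟ target) C) ≤ k ∸ 1
      target-not-unopened   : ∀ {w} → w ∉ S → w ≢ v → target ≢ nodeOf w

  module Insert {S} (st : PartialPartition S) {v} (v∉S : v ∉ S)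
    {C} (C⊆S : All (_∈ S) C) (C-unique : Unique C) (C-clique : IsClique G C)
    (v-adj : ∀ u → u ∈ S → (Adj G v u ⇔ u ∈ C)) (pl : Placement st v C) where

    open PartialPartition st
    open Placement pl

    private
      t : Node
      t = target

      v-adj→ : ∀ {u} → u ∈ S → Adj G v u → u ∈ C
      v-adj→ u∈S = Equivalence.to (v-adj _ u∈S)

      v-adj← : ∀ {u} → u ∈ C → Adj G v u
      v-adj← u∈C = Equivalence.from (v-adj _ (All.lookup C⊆S u∈C)) u∈C

      bagOf′ : V → Node
      bagOf′ = updateAt bagOf v (const t)

      bag-v : bagOf′ v ≡ t
      bag-v = updateAt-updates v bagOf

      bag-old : ∀ {u} → u ∈ S → bagOf′ u ≡ bagOf u
      bag-old {u} u∈S = updateAt-minimal u v bagOf λ { refl → v∉S u∈S }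

      Placed′ : Node → V → Set
      Placed′ x z = z ∈ v ∷ S × bagOf′ z ≡ x

      placed-v : Placed′ t v
      placed-v = here refl , bag-v

      placed-old : ∀ {x z} → Placed x z → Placed′ x z
      placed-old (z∈S , z∈x) = there z∈S , trans (bag-old z∈S) z∈x

      placed-cases : ∀ {x z} → Placed′ x z → (z ≡ v × x ≡ t) ⊎ Placed x z
      placed-cases (here refl , v∈x)  = inj₁ (refl , trans (sym v∈x) bag-v)
      placed-cases (there z∈S , z∈x) = inj₂ (z∈S , trans (sym (bag-old z∈S)) z∈x)

      near-v : ∀ {u} → u ∈ S → Adj G v u → Near t (bagOf u)
      near-v u∈S vu with All.lookup C-near-target (v-adj→ u∈S vu)
      ... | inj₁ u∈t = inj₁ (sym u∈t)
      ... | inj₂ u∈p = inj₂ (inj₁ (trans target-parent (cong just (sym u∈p))))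

      edge-near′ : ∀ {u w} → u ∈ v ∷ S → w ∈ v ∷ S → Adj G u w → Near (bagOf′ u) (bagOf′ w)
      edge-near′ (here refl) (here refl)  vv = ⊥-elim (Adj-irrefl G vv)
      edge-near′ (here refl) (there w∈S)  vw = subst₂ Near (sym bag-v) (sym (bag-old w∈S)) (near-v w∈S vw)
      edge-near′ (there u∈S) (here refl)  uv =
        subst₂ Near (sym (bag-old u∈S)) (sym bag-v) (Near-sym (near-v u∈S (Adj-sym G uv)))
      edge-near′ (there u∈S) (there w∈S) uw =
        subst₂ Near (sym (bag-old u∈S)) (sym (bag-old w∈S)) (edge-near u∈S w∈S uw)

      unopened-empty′ : ∀ {w u} → w ∉ v ∷ S → u ∈ v ∷ S → bagOf′ u ≢ nodeOf w
      unopened-empty′ w∉ (here refl) = λ v∈w → target-not-unopened (w∉ ∘ there) (w∉ ∘ here) (trans (sym bag-v) v∈w)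
      unopened-empty′ w∉ (there u∈S) = λ u∈w → unopened-empty (w∉ ∘ there) u∈S (trans (sym (bag-old u∈S)) u∈w)

      clique-in-parent′ : ∀ x {a} → a ∈ clique x → a ∈ v ∷ S × ∃[ y ] parentOf x ≡ just y × bagOf′ a ≡ y
      clique-in-parent′ x a∈ with clique-in-parent x a∈
      ... | a∈S , y , pxy , a∈y = there a∈S , y , pxy , trans (bag-old a∈S) a∈y

      -- All neighbours of v lie in target or above, so v is never the upper end of an
      -- attachment edge; as the lower end, its partners are the vertices of C in above.
      attachments-in-clique′ : ∀ {x y u w} → parentOf x ≡ just y → Placed′ y u → Placed′ x w → Adj G u w → u ∈ clique x
      attachments-in-clique′ pxy pu pw uw with placed-cases pu | placed-cases pw
      ... | inj₁ (refl , _)    | inj₁ (refl , _) = ⊥-elim (Adj-irrefl G uw)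
      ... | inj₁ (refl , y≡t) | inj₂ (w∈S , w∈x) with All.lookup C-near-target (v-adj→ w∈S uw)
      ...   | inj₁ w∈t = ⊥-elim (parent-irrefl pxy (trans (sym w∈x) (trans w∈t (sym y≡t))))
      ...   | inj₂ w∈p = ⊥-elim (parent-asym target-parent
                           (subst₂ (λ a b → parentOf a ≡ just b) (trans (sym w∈x) w∈p) y≡t pxy))
      attachments-in-clique′ pxy pu pw uw
          | inj₂ (u∈S , u∈y) | inj₁ (refl , refl) =
        C-above-in-clique (v-adj→ u∈S (Adj-sym G uw)) (trans u∈y (just-injective (trans (sym pxy) target-parent)))
      attachments-in-clique′ pxy pu pw uw
          | inj₂ pu-old | inj₂ pw-old = attachments-in-clique pxy pu-old pw-old uw

      own-bag-or-2≤k′ : ∀ {w} → w ∈ v ∷ S → bagOf′ w ≡ nodeOf w ⊎ 2 ≤ k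
      own-bag-or-2≤k′ (here refl) = subst (λ b → b ≡ nodeOf v ⊎ 2 ≤ k) (sym bag-v) target-own-or-2≤k
      own-bag-or-2≤k′ {w} (there w∈S) = subst (λ b → b ≡ nodeOf w ⊎ 2 ≤ k) (sym (bag-old w∈S)) (own-bag-or-2≤k w∈S)

      dominated-by-clique′ : ∀ {w} → w ∈ v ∷ S → Dominated clique w (bagOf′ w)
      dominated-by-clique′ (here refl)     = subst (Dominated clique v) (sym bag-v) target-dominates
      dominated-by-clique′ {w} (there w∈S) = subst (Dominated clique w) (sym (bag-old w∈S)) (dominated-by-clique w∈S)

      C-in-t? : ∀ c → Dec (bagOf c ≡ t)
      C-in-t? c = bagOf c ≟ t

      target-kTree : InducedKTree G (k ∸ 1) (Placed′ t)
      target-kTree with bag-kTree t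
      ... | L , kt , L≡t = v ∷ L , add v (filter C-in-t? C) kt v∉L (Unique.filter⁺ C-in-t? C-unique)
                                     C∩t⊆L C∩t-clique C-in-target-length v-adj-L , v∷L≡t
        where
        v∉L : v ∉ L
        v∉L v∈L = v∉S (proj₁ (Equivalence.to (L≡t v) v∈L))
        C∩t⊆L : All (_∈ L) (filter C-in-t? C)
        C∩t⊆L = All.tabulate λ c∈ → let c∈C , c∈t = ∈-filter⁻ C-in-t? c∈ in
          Equivalence.from (L≡t _) (All.lookup C⊆S c∈C , c∈t)
        C∩t-clique : IsClique G (filter C-in-t? C)
        C∩t-clique a∈ b∈ a≢b = C-clique (proj₁ (∈-filter⁻ C-in-t? a∈)) (proj₁ (∈-filter⁻ C-in-t? b∈)) a≢b
        v-adj-L : ∀ u → u ∈ L → (Adj G v u ⇔ u ∈ filter C-in-t? C)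
        v-adj-L u u∈L = let u∈S , u∈t = Equivalence.to (L≡t u) u∈L in
          mk⇔ (λ vu → ∈-filter⁺ C-in-t? (v-adj→ u∈S vu) u∈t) (λ u∈ → v-adj← (proj₁ (∈-filter⁻ C-in-t? u∈)))
        v∷L≡t : ∀ z → z ∈ v ∷ L ⇔ Placed′ t z
        v∷L≡t z = mk⇔ to from
          where
          to : z ∈ v ∷ L → Placed′ t z
          to (here refl) = placed-v
          to (there z∈L) = placed-old (Equivalence.to (L≡t z) z∈L)
          from : Placed′ t z → z ∈ v ∷ L
          from pz with placed-cases pz
          ... | inj₁ (refl , _) = here refl
          ... | inj₂ pz-old     = there (Equivalence.from (L≡t z) pz-old)

      bag-kTree′ : ∀ x → InducedKTree G (k ∸ 1) (Placed′ x)
      bag-kTree′ x with x ≟ t | bag-kTree x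
      ... | yes refl | _           = target-kTree
      ... | no x≢t   | L , kt , L≡x = L , kt , λ z → mk⇔ (placed-old ∘ Equivalence.to (L≡x z)) (from z)
        where
        from : ∀ z → Placed′ x z → z ∈ L
        from z pz with placed-cases pz
        ... | inj₁ (_ , x≡t) = ⊥-elim (x≢t x≡t)
        ... | inj₂ pz-old    = Equivalence.from (L≡x z) pz-old

      lift : ∀ {x u w} → WalkIn G (Placed x) u w → WalkIn G (Placed′ x) u w
      lift = WalkIn-map placed-old

      walk-from-v : ∀ {w} → Placed t w → WalkIn G (Placed′ t) v w
      walk-from-v pw@(w∈S , w∈t) with target-reached
      ... | inj₂ t-empty = ⊥-elim (t-empty w∈S w∈t)
      ... | inj₁ hit with find hit
      ...   | c , c∈C , c∈t =
        let pc = All.lookup C⊆S c∈C , c∈t in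
        step (v-adj← c∈C) (placed-old pc) (lift (bag-connected t _ _ pc pw))

      bag-connected′ : ∀ x → InducedConnected G (Placed′ x)
      bag-connected′ x u w pu pw with placed-cases pu | placed-cases pw
      ... | inj₁ (refl , _)    | inj₁ (refl , _)    = here
      ... | inj₁ (refl , refl) | inj₂ pw-old        = walk-from-v pw-old
      ... | inj₂ pu-old        | inj₁ (refl , refl) = WalkIn-reverse pw (walk-from-v pu-old)
      ... | inj₂ pu-old        | inj₂ pw-old        = lift (bag-connected x u w pu-old pw-old)

    insert : PartialPartition (v ∷ S)
    insert = record
      { bagOf    = bagOf′
      ; parentOf = parentOf
      ; depthOf  = depthOf
      ; clique   = clique
      ; parentOf-root   = parentOf-root
      ; parentless⇒root = parentless⇒root
      ; depthOf-parent  = depthOf-parent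
      ; edge-near             = edge-near′
      ; unopened-childless    = λ w∉ → unopened-childless (w∉ ∘ there)
      ; unopened-empty        = unopened-empty′
      ; clique-in-parent      = clique-in-parent′
      ; clique-unique         = clique-unique
      ; clique-isClique       = clique-isClique
      ; clique-length         = clique-length
      ; attachments-in-clique = attachments-in-clique′
      ; own-bag-or-2≤k        = own-bag-or-2≤k′
      ; dominated-by-clique   = dominated-by-clique′
      ; bag-kTree             = bag-kTree′
      ; bag-connected         = bag-connected′
      }

  module _ {S} (st : PartialPartition S) {v} (v∉S : v ∉ S)
    {C} (C⊆S : All (_∈ S) C) (C-unique : Unique C) (C-clique : IsClique G C) (C-length : length C ≤ k)
    (v-adj : ∀ u → u ∈ S → (Adj G v u ⇔ u ∈ C)) where

    open PartialPartition st

    private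
      v-adj← : ∀ {u} → u ∈ C → Adj G v u
      v-adj← u∈C = Equivalence.from (v-adj _ (All.lookup C⊆S u∈C)) u∈C

      C-in? : ∀ x c → Dec (bagOf c ≡ x)
      C-in? x c = bagOf c ≟ x

    module _ (p : Node) (p-opened : ∀ {w} → w ∉ S → p ≢ nodeOf w) (C-in-p : All (λ c → bagOf c ≡ p) C) where

      open OpenBag st v∉S p p-opened C⊆S C-in-p C-unique C-clique C-length

      private
        v-dominated : ∀ C′ → (∀ {c} → c ∈ C′ → Adj G v c) → (∃[ a ] a ∈ C′ × Adj G a v) ⊎ C′ ≡ []
        v-dominated []      _     = inj₂ refl
        v-dominated (c ∷ _) v-adj = inj₁ (c , here refl , Adj-sym G (v-adj (here refl)))

        new-dominates : Dominated (PartialPartition.clique openBag) v (nodeOf v)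
        new-dominates with v-dominated C v-adj←
        ... | inj₁ (a , a∈C , av) = inj₁ (a , subst (a ∈_) (sym openBag-clique) a∈C , av)
        ... | inj₂ C≡[]           = inj₂ (trans openBag-clique C≡[] , refl)

      newBagPlacement : Placement openBag v C
      newBagPlacement = record
        { target              = nodeOf v
        ; above               = p
        ; target-parent       = openBag-parent
        ; C-near-target       = All.map inj₂ C-in-p
        ; target-dominates    = new-dominates
        ; target-own-or-2≤k   = inj₁ refl
        ; target-reached      = inj₂ (unopened-empty v∉S)
        ; C-above-in-clique   = λ {u} u∈C _ → subst (u ∈_) (sym openBag-clique) u∈C
        ; C-in-target-length  =
            subst (λ L → length L ≤ k ∸ 1) (sym (filter-none (C-in? (nodeOf v)) (All.map (unopened-empty v∉S) C⊆S))) z≤n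
        ; target-not-unopened = λ _ w≢v v≡w → w≢v (sym (suc-injective v≡w))
        }

    module _ (t p : Node) (t→p : parentOf t ≡ just p) (C-near : All (λ c → bagOf c ≡ t ⊎ bagOf c ≡ p) C)
      (hit-t : Any (λ c → bagOf c ≡ t) C) (hit-p : Any (λ c → bagOf c ≡ p) C) where

      private
        t≢p : t ≢ p
        t≢p = parent-irrefl t→p

        across-adj : ∀ {a b} → a ∈ C → b ∈ C → bagOf a ≡ p → bagOf b ≡ t → Adj G a b
        across-adj a∈C b∈C a∈p b∈t = C-clique a∈C b∈C λ { refl → t≢p (trans (sym b∈t) a∈p) }

        C-above-in-clique : ∀ {u} → u ∈ C → bagOf u ≡ p → u ∈ clique t
        C-above-in-clique u∈C u∈p with find hit-t
        ... | c , c∈C , c∈t = attachments-in-clique t→p (All.lookup C⊆S u∈C , u∈p) (All.lookup C⊆S c∈C , c∈t)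
                                (across-adj u∈C c∈C u∈p c∈t)

        target-dominates : ∃[ a ] a ∈ clique t × Adj G a v
        target-dominates with find hit-p
        ... | c , c∈C , c∈p = c , C-above-in-clique c∈C c∈p , Adj-sym G (v-adj← c∈C)

        C-not-in-t : length (filter (C-in? t) C) < length C
        C-not-in-t = filter-notAll (C-in? t) C (Any.map (λ c∈p c∈t → t≢p (trans (sym c∈t) c∈p)) hit-p)

        target-not-unopened : ∀ {w} → w ∉ S → w ≢ v → t ≢ nodeOf w
        target-not-unopened w∉S _ t≡w with find hit-t
        ... | c , c∈C , c∈t = unopened-empty w∉S (All.lookup C⊆S c∈C) (trans c∈t t≡w)

      joinPlacement : Placement st v C
      joinPlacement = record
        { target              = t
        ; above               = p
        ; target-parent       = t→p
        ; C-near-target       = C-near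
        ; target-dominates    = inj₁ target-dominates
        ; target-own-or-2≤k   = inj₂ (≤-trans (s≤s (filter-some (C-in? t) hit-t)) (≤-trans C-not-in-t C-length))
        ; target-reached      = inj₁ hit-t
        ; C-above-in-clique   = C-above-in-clique
        ; C-in-target-length  = ∸-monoˡ-≤ 1 (≤-trans C-not-in-t C-length)
        ; target-not-unopened = target-not-unopened
        }

  clique-near : ∀ {S} (st : PartialPartition S) {C} → All (_∈ S) C → IsClique G C →
                ∀ {a b} → a ∈ C → b ∈ C → PartialPartition.Near st (PartialPartition.bagOf st a) (PartialPartition.bagOf st b)
  clique-near st C⊆S C-clique {a} {b} a∈C b∈C with a ≟ b
  ... | yes refl = inj₁ refl
  ... | no a≢b   = PartialPartition.edge-near st (All.lookup C⊆S a∈C) (All.lookup C⊆S b∈C) (C-clique a∈C b∈C a≢b)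

  extend : ∀ {S} → PartialPartition S → ∀ {v} C → v ∉ S → Unique C → All (_∈ S) C → IsClique G C → length C ≤ k →
           (∀ u → u ∈ S → (Adj G v u ⇔ u ∈ C)) → PartialPartition (v ∷ S)
  extend st [] v∉S C-unique C⊆S C-clique C-length v-adj =
    Insert.insert (OpenBag.openBag st v∉S rootNode (λ _ ()) C⊆S [] C-unique C-clique C-length) v∉S C⊆S C-unique C-clique v-adj
      (newBagPlacement st v∉S C⊆S C-unique C-clique C-length v-adj rootNode (λ _ ()) [])
  extend st (c ∷ cs) v∉S C-unique C⊆S C-clique C-length v-adj
    with PartialPartition.span st (PartialPartition.bagOf st) _≟_ c cs (clique-near st C⊆S C-clique)
  ... | within p C-in-p =
    Insert.insert (OpenBag.openBag st v∉S p p-opened C⊆S C-in-p C-unique C-clique C-length) v∉S C⊆S C-unique C-clique v-adj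
      (newBagPlacement st v∉S C⊆S C-unique C-clique C-length v-adj p p-opened C-in-p)
    where
    p-opened : ∀ {w} → w ∉ _ → p ≢ nodeOf w
    p-opened w∉S p≡w = PartialPartition.unopened-empty st w∉S (All.lookup C⊆S (here refl)) (trans (All.lookup C-in-p (here refl)) p≡w)
  ... | across t p t→p C-near hit-t hit-p =
    Insert.insert st v∉S C⊆S C-unique C-clique v-adj (joinPlacement st v∉S C⊆S C-unique C-clique C-length v-adj t p t→p C-near hit-t hit-p)

  build : ∀ {S} → KTreeOn G k S → PartialPartition S
  build empty = initial
  build (add v C kt v∉S C-unique C⊆S C-clique C-length v-adj) =
    extend (build kt) C v∉S C-unique C⊆S C-clique C-length v-adj

module Complete (G : Graph) (k : ℕ) {S} (st : Construction.PartialPartition G k S)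
  (everyone : ∀ v → v ∈ S) where

  open Construction G k
  open PartialPartition st

  rootedTree : RootedTree
  rootedTree = record
    { m      = suc (n G)
    ; root   = rootNode
    ; parent = parentOf
    ; rootP  = λ x → mk⇔ (parentless⇒root x) λ { refl → parentOf-root }
    ; depth  = depthOf
    ; depthP = depthOf-parent
    }

  partition : RootedTreePartition G
  partition = record
    { tree   = rootedTree
    ; bag    = bagOf
    ; edgeOK = λ u w → edge-near (everyone u) (everyone w)
    }

  partition-propA : PropA partition
  partition-propA x y x→y u w (u∈y , u′ , u′∈x , uu′) (w∈y , w′ , w′∈x , ww′) =
    clique-isClique x (attached u∈y u′∈x uu′) (attached w∈y w′∈x ww′)
    where
    attached : ∀ {a b} → bagOf a ≡ y → bagOf b ≡ x → Adj G a b → a ∈ clique x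
    attached a∈y b∈x ab = attachments-in-clique x→y (everyone _ , a∈y) (everyone _ , b∈x) ab

  partition-propB : PropB k partition
  partition-propB x = connected , kTree
    where
    connected : InducedConnected G (InBag partition x)
    connected u w u∈x w∈x = WalkIn-map proj₂ (bag-connected x u w (everyone u , u∈x) (everyone w , w∈x))
    kTree : InducedKTree G (k ∸ 1) (InBag partition x)
    kTree with bag-kTree x
    ... | L , kt , L≡x = L , kt , λ z → mk⇔ (proj₂ ∘ Equivalence.to (L≡x z)) (Equivalence.from (L≡x z) ∘ (everyone z ,_))

  private
    Δ : ℕ
    Δ = maxDegree G

    module Fiber = FiberCount G bagOf

    own-bags : ∀ x → (∀ {w} → bagOf w ≡ x → bagOf w ≡ nodeOf w) → Fiber.fiberSize x ≤ 1
    own-bags x own = Fiber.fiber-subsingleton x λ w∈x w′∈x →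
      suc-injective (trans (sym (own w∈x)) (trans w∈x (trans (sym w′∈x) (own w′∈x))))

    alone : ∀ {x} → clique x ≡ [] → ∀ {w} → bagOf w ≡ x → bagOf w ≡ nodeOf w
    alone cx≡[] {w} refl with dominated-by-clique (everyone w)
    ... | inj₁ (b , b∈ , _) with () ← subst (b ∈_) cx≡[] b∈
    ... | inj₂ (_ , own)    = own

    dominated : ∀ {x a r} → clique x ≡ a ∷ r → ∀ {w} → bagOf w ≡ x → ∃[ b ] b ∈ a ∷ r × Adj G b w
    dominated cx≡ {w} refl with dominated-by-clique (everyone w)
    ... | inj₁ (b , b∈ , bw) = b , subst (b ∈_) cx≡ b∈ , bw
    ... | inj₂ (none , _)    with () ← trans (sym cx≡) none

    clique-outside : ∀ {x d} → d ∈ clique x → bagOf d ≢ x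
    clique-outside {x} d∈ d∈x with clique-in-parent x d∈
    ... | _ , y , x→y , d∈y = parent-irrefl x→y (trans (sym d∈x) d∈y)

  partition-width : WidthAtMost partition (1 ⊔ k * (maxDegree G ∸ 1))
  partition-width x with 2 ≤? k | clique x in cx≡
  ... | no k≱2 | _ =
    ≤-trans (own-bags x λ {w} _ → own-bag (own-bag-or-2≤k (everyone w))) (m≤m⊔n 1 (k * (Δ ∸ 1)))
    where
    own-bag : ∀ {w} → bagOf w ≡ nodeOf w ⊎ 2 ≤ k → bagOf w ≡ nodeOf w
    own-bag = [ id , ⊥-elim ∘ k≱2 ]
  ... | yes _   | [] = ≤-trans (own-bags x (alone cx≡)) (m≤m⊔n 1 (k * (Δ ∸ 1)))
  ... | yes 2≤k | a ∷ [] =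
    ≤-trans (Fiber.fiber-dominated x (a ∷ []) (dominated cx≡) (λ _ → Fiber.∑-neighbourInFiber-≤ x _))
            (≤-trans (≤-reflexive (+-identityʳ Δ)) (n≤1⊔k*[n∸1] Δ 2≤k))
  ... | yes _   | a ∷ b ∷ r =
    ≤-trans (Fiber.fiber-dominated x (a ∷ b ∷ r) (dominated cx≡) spends-one)
            (m≤n⇒m≤o⊔n 1 (*-monoˡ-≤ (Δ ∸ 1) (subst (λ L → length L ≤ k) cx≡ (clique-length x))))
    where
    spends-one : ∀ {c} → c ∈ a ∷ b ∷ r → ∑ (Fiber.neighbourInFiber x c) ≤ Δ ∸ 1
    spends-one c∈ with other-member (subst Unique cx≡ (clique-unique x)) c∈
    ... | d , d∈ , c≢d = Fiber.∑-neighbourInFiber-≤-pred x (subst (IsClique G) cx≡ (clique-isClique x) c∈ d∈ c≢d)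
                           (clique-outside (subst (d ∈_) (sym cx≡) d∈))

theorem6p1 : (k : ℕ) → 1 ≤ k → (G : Graph) → IsKTree k G →
    Σ (RootedTreePartition G) λ P →
      PropA P × PropB k P × WidthAtMost P (1 ⊔ (k * (maxDegree G ∸ 1)))
theorem6p1 k _ G (S , kt , S≡V) = partition , partition-propA , partition-propB , partition-width
  where open Complete G k (Construction.build G k kt) (λ v → Equivalence.from (S≡V v) tt)
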